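{- Let $D=\{0,1\}$ with the order $0<1$. Then the set $\varGamma_{\mathrm{SOF}}$ of all safely OR-free relations on $\{0,1\}$ equals $\mathrm{Inv}(M_{D,\le})$, the set of all relations on $\{0,1\}$ invariant under $M_{D,\le}$.
   Context: For an $r$-ary relation $R$ on $\{0,1\}$ and $0<k<r$, a relation $R'(x_1,\dots,x_{r-k})=R(\xi_1,\dots,\xi_r)$ with each $\xi_j\in\{x_1,\dots,x_{r-k}\}\cup\{0,1\}$ is obtained from $R$ by substitution of constants if each variable occurs at most once among the $\xi_j$, and by identification of variables if every $\xi_j$ is a variable. $R$ is OR-free if $\mathrm{OR}=\{(0,1),(1,0),(1,1)\}$ cannot be obtained from $R$ by substitution of constants; $R$ is safely OR-free if $R$ and every relation obtained from $R$ by identification of variables are OR-free. For a finite totally ordered set $(D,\le)$, $M_{D,\le}$ is the ternary partial operation with $M_{D,\le}(x,y,y)=M_{D,\le}(y,y,x)=x$ whenever $x\le y$, undefined otherwise. A partial operation acts on tuples coordinatewise (defined iff all coordinates are defined); a relation is invariant under it if every defined result of applying it to tuples of the relation lies in the relation. -}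

module Defs where

open import Data.Bool using (Bool; true; false; _∧_; _∨_)
open import Data.Nat using (ℕ; _<_; _≤_)
open import Data.Fin using (Fin)
open import Data.Vec using (Vec; lookup; tabulate; _∷_; [])
open import Data.Sum using (_⊎_; inj₁; inj₂)
open import Data.Product using (Σ; _×_; _,_; ∃)
open import Data.Maybe using (Maybe; just; nothing)
open import Relation.Binary.PropositionalEquality using (_≡_)
open import Relation.Nullary using (¬_)
open import Data.Unit using (⊤)
open import Data.Empty using (⊥)

-- An r-ary relation on {0,1} = Bool (false = 0, true = 1),
-- given by its characteristic function: t ∈ R  iff  R t ≡ true.
Rel₂ : ℕ → Set
Rel₂ r = Vec Bool r → Bool

OR : Rel₂ 2
OR (x ∷ y ∷ []) = x ∨ y

evalTerm : ∀ {m} → Vec Bool m → Fin m ⊎ Bool → Bool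
evalTerm xs (inj₁ i) = lookup xs i
evalTerm xs (inj₂ b) = b

VarsAtMostOnce : ∀ {r m} → (Fin r → Fin m ⊎ Bool) → Set
VarsAtMostOnce {r} {m} ξ = ∀ (j j' : Fin r) (i : Fin m) →
  ξ j ≡ inj₁ i → ξ j' ≡ inj₁ i → j ≡ j'

DefinedBy : ∀ {r m} → Rel₂ r → Rel₂ m → (Fin r → Fin m ⊎ Bool) → Set
DefinedBy {r} {m} R R' ξ =
  ∀ (xs : Vec Bool m) → R' xs ≡ R (tabulate (λ j → evalTerm xs (ξ j)))

BySubstConst : ∀ {r m} → Rel₂ r → Rel₂ m → Set
BySubstConst {r} {m} R R' =
  (0 < m) × (m ≤ r) ×
  Σ (Fin r → Fin m ⊎ Bool) (λ ξ → VarsAtMostOnce ξ × DefinedBy R R' ξ)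

ByIdent : ∀ {r m} → Rel₂ r → Rel₂ m → Set
ByIdent {r} {m} R R' =
  (0 < m) × (m < r) ×
  Σ (Fin r → Fin m) (λ ξ → DefinedBy R R' (λ j → inj₁ (ξ j)))

OrFree : ∀ {r} → Rel₂ r → Set
OrFree R = ¬ BySubstConst R OR

SafelyOrFree : ∀ {r} → Rel₂ r → Set
SafelyOrFree {r} R =
  OrFree R × (∀ (m : ℕ) (R' : Rel₂ m) → ByIdent R R' → OrFree R')

_≤B_ : Bool → Bool → Set
false ≤B _     = ⊤
true  ≤B false = ⊥
true  ≤B true  = ⊤

-- Graph of the partial operation M_{D,≤}:
-- M(x,y,y) = x and M(y,y,x) = x whenever x ≤ y; undefined otherwise.
-- (On (a,a,a) both clauses give a, so this is a well-defined partial function.)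
MGraph : Bool → Bool → Bool → Bool → Set
MGraph a b c d = ((b ≡ c) × (a ≤B b) × (d ≡ a)) ⊎ ((a ≡ b) × (c ≤B a) × (d ≡ c))

InvM : ∀ {r} → Rel₂ r → Set
InvM {r} R = ∀ (t₁ t₂ t₃ t : Vec Bool r) →
  R t₁ ≡ true → R t₂ ≡ true → R t₃ ≡ true →
  (∀ (i : Fin r) → MGraph (lookup t₁ i) (lookup t₂ i) (lookup t₃ i) (lookup t i)) →
  R t ≡ true

-- A relation R on {0,1} is invariant under M exactly when it is closed under
-- a ∧ b for all a, b ∈ R with a ∨ b ∈ R, because M(t₁,t₂,t₃) is defined iff
-- t₂ = t₁ ∨ t₃ and then equals t₁ ∧ t₃. This closure property passes to every
-- relation defined from R by a substitution, and OR lacks it, which gives one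
-- inclusion. Conversely, let a, b, a ∨ b ∈ R with a ∧ b ∉ R. If two coordinates
-- carry the same column (aₖ, bₖ), identifying them yields a counterexample of
-- smaller arity that is still safely OR-free. Otherwise the columns are pairwise
-- distinct, and substituting x for the column (1,0), y for (0,1) and the
-- constants for (0,0) and (1,1) defines OR(x,y) from R.
module Submission where

open import Defs
open import Data.Bool using (Bool; true; false; _∧_; _∨_)
open import Data.Bool.Properties using (∨-idem; ∧-idem) renaming (_≟_ to _≟ᴮ_)
open import Data.Empty using (⊥)
open import Data.Fin using (Fin; zero; suc; punchOut; _≟_)
open import Data.Fin.Properties using (any?)
open import Data.Nat using (ℕ; zero; suc; _<_; s≤s; z≤n)
open import Data.Nat.Properties using (≤-refl; <-trans)
open import Data.Product using (_×_; _,_; proj₁; proj₂; ∃₂)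
open import Data.Product.Properties using (≡-dec)
open import Data.Sum using (_⊎_; inj₁; inj₂; [_,_]′)
open import Data.Unit using (tt)
open import Data.Vec using (Vec; []; _∷_; lookup; tabulate; zipWith; removeAt)
open import Data.Vec.Properties
  using (lookup∘tabulate; tabulate∘lookup; tabulate-cong; lookup-zipWith; removeAt-punchOut)
open import Function using (_∘_)
open import Function.Definitions using (Injective)
open import Relation.Binary.Definitions using (DecidableEquality)
open import Relation.Nullary using (¬_; yes; no; contradiction)
open import Relation.Nullary.Decidable using (_×-dec_; ¬?)
open import Relation.Binary.PropositionalEquality
  using (_≡_; _≢_; refl; sym; trans; cong; cong₂; subst; module ≡-Reasoning)

private
  variable
    r m n : ℕ

_∨ᵛ_ _∧ᵛ_ : Vec Bool r → Vec Bool r → Vec Bool r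
_∨ᵛ_ = zipWith _∨_
_∧ᵛ_ = zipWith _∧_

MeetClosed : Rel₂ r → Set
MeetClosed R = ∀ a b → R a ≡ true → R b ≡ true → R (a ∨ᵛ b) ≡ true → R (a ∧ᵛ b) ≡ true

record MeetFailure (R : Rel₂ r) (a b : Vec Bool r) : Set where
  field
    a∈R   : R a ≡ true
    b∈R   : R b ≡ true
    a∨b∈R : R (a ∨ᵛ b) ≡ true
    a∧b∉R : R (a ∧ᵛ b) ≡ false

MeetFailure⇒meet≢ : {R : Rel₂ r} {a b : Vec Bool r} → MeetFailure R a b → a ∧ᵛ b ≢ a × a ∧ᵛ b ≢ b
MeetFailure⇒meet≢ {R = R} failure =
  (λ meet≡a → contradiction (trans (sym a∈R) (trans (cong R (sym meet≡a)) a∧b∉R)) λ ()) ,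
  (λ meet≡b → contradiction (trans (sym b∈R) (trans (cong R (sym meet≡b)) a∧b∉R)) λ ())
  where open MeetFailure failure

lookup-ext : {u v : Vec Bool r} → (∀ i → lookup u i ≡ lookup v i) → u ≡ v
lookup-ext {u = u} {v} eq = begin
  u                   ≡⟨ sym (tabulate∘lookup u) ⟩
  tabulate (lookup u) ≡⟨ tabulate-cong eq ⟩
  tabulate (lookup v) ≡⟨ tabulate∘lookup v ⟩
  v                   ∎
  where open ≡-Reasoning

MGraph⇒join×meet : ∀ x y z t → MGraph x y z t → y ≡ x ∨ z × t ≡ x ∧ z
MGraph⇒join×meet false false false false (inj₁ (refl , _ , refl)) = refl , refl
MGraph⇒join×meet false true  true  false (inj₁ (refl , _ , refl)) = refl , refl
MGraph⇒join×meet true  true  true  true  (inj₁ (refl , _ , refl)) = refl , refl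
MGraph⇒join×meet true  false false true  (inj₁ (refl , () , refl))
MGraph⇒join×meet false false false false (inj₂ (refl , _ , refl)) = refl , refl
MGraph⇒join×meet true  true  false false (inj₂ (refl , _ , refl)) = refl , refl
MGraph⇒join×meet true  true  true  true  (inj₂ (refl , _ , refl)) = refl , refl
MGraph⇒join×meet false false true  true  (inj₂ (refl , () , refl))

MGraph-join-meet : ∀ x z → MGraph x (x ∨ z) z (x ∧ z)
MGraph-join-meet false false = inj₁ (refl , tt , refl)
MGraph-join-meet false true  = inj₁ (refl , tt , refl)
MGraph-join-meet true  false = inj₂ (refl , tt , refl)
MGraph-join-meet true  true  = inj₁ (refl , tt , refl)

invM⇒meetClosed : (R : Rel₂ r) → InvM R → MeetClosed R
invM⇒meetClosed R inv a b a∈R b∈R a∨b∈R = inv a (a ∨ᵛ b) b (a ∧ᵛ b) a∈R a∨b∈R b∈R graph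
  where
  graph : ∀ i → MGraph (lookup a i) (lookup (a ∨ᵛ b) i) (lookup b i) (lookup (a ∧ᵛ b) i)
  graph i rewrite lookup-zipWith _∨_ i a b | lookup-zipWith _∧_ i a b =
    MGraph-join-meet (lookup a i) (lookup b i)

meetClosed⇒invM : (R : Rel₂ r) → MeetClosed R → InvM R
meetClosed⇒invM R closed t₁ t₂ t₃ t t₁∈R t₂∈R t₃∈R graph =
  subst (λ v → R v ≡ true) (sym t≡meet)
    (closed t₁ t₃ t₁∈R t₃∈R (subst (λ v → R v ≡ true) t₂≡join t₂∈R))
  where
  pointwise : ∀ i → lookup t₂ i ≡ lookup t₁ i ∨ lookup t₃ i × lookup t i ≡ lookup t₁ i ∧ lookup t₃ i
  pointwise i = MGraph⇒join×meet _ _ _ _ (graph i)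
  t₂≡join : t₂ ≡ t₁ ∨ᵛ t₃
  t₂≡join = lookup-ext λ i → trans (proj₁ (pointwise i)) (sym (lookup-zipWith _∨_ i t₁ t₃))
  t≡meet : t ≡ t₁ ∧ᵛ t₃
  t≡meet = lookup-ext λ i → trans (proj₂ (pointwise i)) (sym (lookup-zipWith _∧_ i t₁ t₃))

substitute : (Fin r → Fin m ⊎ Bool) → Vec Bool m → Vec Bool r
substitute ξ xs = tabulate (λ j → evalTerm xs (ξ j))

substitute-zipWith : (_∙_ : Bool → Bool → Bool) → (∀ x → x ∙ x ≡ x) →
  (ξ : Fin r → Fin m ⊎ Bool) (xs ys : Vec Bool m) →
  substitute ξ (zipWith _∙_ xs ys) ≡ zipWith _∙_ (substitute ξ xs) (substitute ξ ys)
substitute-zipWith _∙_ idem ξ xs ys = lookup-ext λ j → begin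
  lookup (substitute ξ (zipWith _∙_ xs ys)) j
    ≡⟨ lookup∘tabulate _ j ⟩
  evalTerm (zipWith _∙_ xs ys) (ξ j)
    ≡⟨ evalTerm-zipWith (ξ j) ⟩
  evalTerm xs (ξ j) ∙ evalTerm ys (ξ j)
    ≡˘⟨ cong₂ _∙_ (lookup∘tabulate _ j) (lookup∘tabulate _ j) ⟩
  lookup (substitute ξ xs) j ∙ lookup (substitute ξ ys) j
    ≡˘⟨ lookup-zipWith _∙_ j (substitute ξ xs) (substitute ξ ys) ⟩
  lookup (zipWith _∙_ (substitute ξ xs) (substitute ξ ys)) j
    ∎
  where
  open ≡-Reasoning
  evalTerm-zipWith : ∀ t → evalTerm (zipWith _∙_ xs ys) t ≡ evalTerm xs t ∙ evalTerm ys t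
  evalTerm-zipWith (inj₁ i) = lookup-zipWith _∙_ i xs ys
  evalTerm-zipWith (inj₂ c) = sym (idem c)

DefinedBy-meetClosed : {R : Rel₂ r} {R′ : Rel₂ m} {ξ : Fin r → Fin m ⊎ Bool} →
  DefinedBy R R′ ξ → MeetClosed R → MeetClosed R′
DefinedBy-meetClosed {R = R} {R′} {ξ} def closed a b a∈R′ b∈R′ a∨b∈R′ = begin
  R′ (a ∧ᵛ b)                          ≡⟨ def (a ∧ᵛ b) ⟩
  R (substitute ξ (a ∧ᵛ b))            ≡⟨ cong R (substitute-zipWith _∧_ ∧-idem ξ a b) ⟩
  R (substitute ξ a ∧ᵛ substitute ξ b) ≡⟨ closed _ _ (lift a a∈R′) (lift b b∈R′) join∈R ⟩
  true                                 ∎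
  where
  open ≡-Reasoning
  lift : ∀ c → R′ c ≡ true → R (substitute ξ c) ≡ true
  lift c c∈R′ = trans (sym (def c)) c∈R′
  join∈R : R (substitute ξ a ∨ᵛ substitute ξ b) ≡ true
  join∈R = subst (λ v → R v ≡ true) (substitute-zipWith _∨_ ∨-idem ξ a b) (lift (a ∨ᵛ b) a∨b∈R′)

OR-not-meetClosed : ¬ MeetClosed OR
OR-not-meetClosed closed with closed (true ∷ false ∷ []) (false ∷ true ∷ []) refl refl refl
... | ()

meetClosed⇒orFree : (R : Rel₂ r) → MeetClosed R → OrFree R
meetClosed⇒orFree R closed (_ , _ , ξ , _ , def) =
  OR-not-meetClosed (DefinedBy-meetClosed {ξ = ξ} def closed)

meetClosed⇒safelyOrFree : (R : Rel₂ r) → MeetClosed R → SafelyOrFree R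
meetClosed⇒safelyOrFree R closed =
  meetClosed⇒orFree R closed ,
  λ _ R′ (_ , _ , ξ , def) → meetClosed⇒orFree R′ (DefinedBy-meetClosed {ξ = inj₁ ∘ ξ} def closed)

MeetFailure-substitute : {R : Rel₂ r} {a b : Vec Bool r}
  (ξ : Fin r → Fin m ⊎ Bool) (a′ b′ : Vec Bool m) → substitute ξ a′ ≡ a → substitute ξ b′ ≡ b →
  MeetFailure R a b → MeetFailure (R ∘ substitute ξ) a′ b′
MeetFailure-substitute {R = R} ξ a′ b′ refl refl failure = record
  { a∈R   = a∈R
  ; b∈R   = b∈R
  ; a∨b∈R = trans (cong R (substitute-zipWith _∨_ ∨-idem ξ a′ b′)) a∨b∈R
  ; a∧b∉R = trans (cong R (substitute-zipWith _∧_ ∧-idem ξ a′ b′)) a∧b∉R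
  }
  where open MeetFailure failure

substitute-inj₁-∘ : (f : Fin r → Fin m) (g : Fin m → Fin n) (xs : Vec Bool n) →
  substitute (inj₁ ∘ f) (substitute (inj₁ ∘ g) xs) ≡ substitute (inj₁ ∘ g ∘ f) xs
substitute-inj₁-∘ f g xs = tabulate-cong λ j → lookup∘tabulate _ (f j)

ByIdent-trans : {R : Rel₂ r} {R′ : Rel₂ m} {R″ : Rel₂ n} →
  ByIdent R R′ → ByIdent R′ R″ → ByIdent R R″
ByIdent-trans {R = R} (_ , m<r , f , def) (0<n , n<m , g , def′) =
  0<n , <-trans n<m m<r , g ∘ f ,
  λ xs → trans (def′ xs) (trans (def _) (cong R (substitute-inj₁-∘ f g xs)))

safelyOrFree-ByIdent : {R : Rel₂ r} {R′ : Rel₂ m} → SafelyOrFree R → ByIdent R R′ → SafelyOrFree R′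
safelyOrFree-ByIdent {R = R} {R′} (_ , identFree) R→R′ =
  identFree _ R′ R→R′ , λ n R″ R′→R″ → identFree n R″ (ByIdent-trans {R = R} R→R′ R′→R″)

module IdentifyCoordinates {k₁ k₂ : Fin (suc m)} (k₂≢k₁ : k₂ ≢ k₁) where

  merge : Fin (suc m) → Fin m
  merge k with k₂ ≟ k
  ... | yes _   = punchOut k₂≢k₁
  ... | no k₂≢k = punchOut k₂≢k

  substitute-merge-removeAt : (c : Vec Bool (suc m)) → lookup c k₁ ≡ lookup c k₂ →
    substitute (inj₁ ∘ merge) (removeAt c k₂) ≡ c
  substitute-merge-removeAt c c₁≡c₂ =
    lookup-ext λ k → trans (lookup∘tabulate (lookup (removeAt c k₂) ∘ merge) k) (lookup-merge k)
    where
    lookup-merge : ∀ k → lookup (removeAt c k₂) (merge k) ≡ lookup c k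
    lookup-merge k with k₂ ≟ k
    ... | yes refl = trans (removeAt-punchOut c k₂≢k₁) c₁≡c₂
    ... | no k₂≢k = removeAt-punchOut c k₂≢k

  ByIdent-merge : (R : Rel₂ (suc m)) → 0 < m → ByIdent R (R ∘ substitute (inj₁ ∘ merge))
  ByIdent-merge R 0<m = 0<m , ≤-refl , merge , λ _ → refl

collision-or-injective : {A : Set} → DecidableEquality A → (f : Fin r → A) →
  (∃₂ λ k₁ k₂ → k₂ ≢ k₁ × f k₁ ≡ f k₂) ⊎ Injective _≡_ _≡_ f
collision-or-injective _≟ᴬ_ f with any? (λ k₁ → any? λ k₂ → ¬? (k₂ ≟ k₁) ×-dec (f k₁ ≟ᴬ f k₂))
... | yes (k₁ , k₂ , collision) = inj₁ (k₁ , k₂ , collision)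
... | no noCollision = inj₂ injective
  where
  injective : Injective _≡_ _≡_ f
  injective {k₁} {k₂} fk₁≡fk₂ with k₂ ≟ k₁
  ... | yes k₂≡k₁ = sym k₂≡k₁
  ... | no k₂≢k₁ = contradiction (k₁ , k₂ , k₂≢k₁ , fk₁≡fk₂) noCollision

column : Vec Bool r → Vec Bool r → Fin r → Bool × Bool
column a b k = lookup a k , lookup b k

orPattern : Bool × Bool → Fin 2 ⊎ Bool
orPattern (true  , false) = inj₁ zero
orPattern (false , true)  = inj₁ (suc zero)
orPattern (false , false) = inj₂ false
orPattern (true  , true)  = inj₂ true

orPattern-variable : (p : Bool × Bool) (i : Fin 2) → orPattern p ≡ inj₁ i →
  p ≡ (lookup (true ∷ false ∷ []) i , lookup (false ∷ true ∷ []) i)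
orPattern-variable (true  , false) _ refl = refl
orPattern-variable (false , true)  _ refl = refl

orPattern-eval : ∀ p →
  evalTerm (false ∷ false ∷ []) (orPattern p) ≡ proj₁ p ∧ proj₂ p ×
  evalTerm (true  ∷ false ∷ []) (orPattern p) ≡ proj₁ p           ×
  evalTerm (false ∷ true  ∷ []) (orPattern p) ≡ proj₂ p           ×
  evalTerm (true  ∷ true  ∷ []) (orPattern p) ≡ proj₁ p ∨ proj₂ p
orPattern-eval (false , false) = refl , refl , refl , refl
orPattern-eval (false , true)  = refl , refl , refl , refl
orPattern-eval (true  , false) = refl , refl , refl , refl
orPattern-eval (true  , true)  = refl , refl , refl , refl

distinctColumns⇒OR : {R : Rel₂ (suc (suc n))} {a b : Vec Bool (suc (suc n))} →
  MeetFailure R a b → Injective _≡_ _≡_ (column a b) → BySubstConst R OR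
distinctColumns⇒OR {R = R} {a} {b} failure injective = s≤s z≤n , s≤s (s≤s z≤n) , ξ , once , def
  where
  open MeetFailure failure
  ξ : Fin _ → Fin 2 ⊎ Bool
  ξ = orPattern ∘ column a b
  once : VarsAtMostOnce ξ
  once j j′ i ξj≡i ξj′≡i =
    injective (trans (orPattern-variable _ i ξj≡i) (sym (orPattern-variable _ i ξj′≡i)))
  substitute-ξ : ∀ {x y} {c : Vec Bool _} →
    (∀ k → evalTerm (x ∷ y ∷ []) (ξ k) ≡ lookup c k) → substitute ξ (x ∷ y ∷ []) ≡ c
  substitute-ξ {x} {y} pointwise =
    lookup-ext λ k → trans (lookup∘tabulate (evalTerm (x ∷ y ∷ []) ∘ ξ) k) (pointwise k)
  def : DefinedBy R OR ξ
  def (false ∷ false ∷ []) = sym (trans (cong R (substitute-ξ λ k →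
    trans (proj₁ (orPattern-eval (column a b k))) (sym (lookup-zipWith _∧_ k a b)))) a∧b∉R)
  def (true ∷ false ∷ []) =
    sym (trans (cong R (substitute-ξ (proj₁ ∘ proj₂ ∘ orPattern-eval ∘ column a b))) a∈R)
  def (false ∷ true ∷ []) =
    sym (trans (cong R (substitute-ξ (proj₁ ∘ proj₂ ∘ proj₂ ∘ orPattern-eval ∘ column a b))) b∈R)
  def (true ∷ true ∷ []) = sym (trans (cong R (substitute-ξ λ k →
    trans (proj₂ (proj₂ (proj₂ (orPattern-eval (column a b k)))))
          (sym (lookup-zipWith _∨_ k a b)))) a∨b∈R)

NoMeetFailure : ℕ → Set
NoMeetFailure r = (R : Rel₂ r) → SafelyOrFree R → {a b : Vec Bool r} → ¬ MeetFailure R a b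

noMeetFailure-step : NoMeetFailure (suc n) → NoMeetFailure (suc (suc n))
noMeetFailure-step ih R sof {a} {b} failure =
  [ identifyRepeatedColumns , distinctColumns ]′
    (collision-or-injective (≡-dec _≟ᴮ_ _≟ᴮ_) (column a b))
  where
  distinctColumns : Injective _≡_ _≡_ (column a b) → ⊥
  distinctColumns injective = proj₁ sof (distinctColumns⇒OR failure injective)
  identifyRepeatedColumns : (∃₂ λ k₁ k₂ → k₂ ≢ k₁ × column a b k₁ ≡ column a b k₂) → ⊥
  identifyRepeatedColumns (k₁ , k₂ , k₂≢k₁ , same-column) =
    ih (R ∘ substitute (inj₁ ∘ merge))
      (safelyOrFree-ByIdent {R = R} sof (ByIdent-merge R (s≤s z≤n)))
      (MeetFailure-substitute (inj₁ ∘ merge) (removeAt a k₂) (removeAt b k₂)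
        (substitute-merge-removeAt a (cong proj₁ same-column))
        (substitute-merge-removeAt b (cong proj₂ same-column))
        failure)
    where open IdentifyCoordinates k₂≢k₁

noMeetFailure : ∀ r → NoMeetFailure r
noMeetFailure zero          _ _ {[]}         {[]}     failure = proj₁ (MeetFailure⇒meet≢ failure) refl
noMeetFailure (suc zero)    _ _ {false ∷ []} {_ ∷ []} failure = proj₁ (MeetFailure⇒meet≢ failure) refl
noMeetFailure (suc zero)    _ _ {true ∷ []}  {_ ∷ []} failure = proj₂ (MeetFailure⇒meet≢ failure) refl
noMeetFailure (suc (suc n)) = noMeetFailure-step (noMeetFailure (suc n))

safelyOrFree⇒meetClosed : (R : Rel₂ r) → SafelyOrFree R → MeetClosed R
safelyOrFree⇒meetClosed R sof a b a∈R b∈R a∨b∈R with R (a ∧ᵛ b) in a∧b∈?R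
... | true  = refl
... | false = contradiction (record { a∈R = a∈R ; b∈R = b∈R ; a∨b∈R = a∨b∈R ; a∧b∉R = a∧b∈?R })
                            (noMeetFailure _ R sof)

theorem39 : ∀ (r : ℕ) (R : Rel₂ r) → (SafelyOrFree R → InvM R) × (InvM R → SafelyOrFree R)
theorem39 r R =
  (λ sof → meetClosed⇒invM R (safelyOrFree⇒meetClosed R sof)) ,
  (λ inv → meetClosed⇒safelyOrFree R (invM⇒meetClosed R inv))
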